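{- Let $m,n$ be nonnegative integers. Then every cyclic permutation $[\sigma]$ of length $mn+2$ contains either $[\iota_{m+2}]$ or $[\delta_{n+2}]$. This is best possible: there exist cyclic permutations of length $mn+1$ which avoid both $[\iota_{m+2}]$ and $[\delta_{n+2}]$.
   Context: For $k\ge1$, $\iota_k=12\ldots k$ and $\delta_k=k\ldots 21$. For a linear permutation $\pi=\pi_1\ldots\pi_n$ of $[n]=\{1,\ldots,n\}$, the cyclic permutation $[\pi]$ is the set of all rotations $\pi_i\pi_{i+1}\ldots\pi_n\pi_1\ldots\pi_{i-1}$ of $\pi$; its length is $n$. Two sequences of distinct integers $a_1\ldots a_k$, $b_1\ldots b_k$ are order isomorphic if $a_i<a_j \iff b_i<b_j$. A linear permutation $\sigma$ contains a linear permutation $\pi$ if some subsequence of $\sigma$ is order isomorphic to $\pi$. A cyclic permutation $[\sigma]$ contains $[\pi]$ if some rotation of $\sigma$ contains $\pi$ linearly; otherwise $[\sigma]$ avoids $[\pi]$. -}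

module Defs where

open import Data.Nat using (ℕ; zero; suc; _+_; _*_)
open import Data.Nat.DivMod using (_mod_)
open import Data.Fin using (Fin; toℕ; opposite) renaming (_<_ to _<ᶠ_)
open import Data.Product using (Σ; ∃; _×_; _,_)
open import Function using (_⇔_)
open import Function.Definitions using (Injective)
open import Relation.Binary.PropositionalEquality using (_≡_)

-- A linear permutation of [N], encoded 0-based: an injective map Fin N → Fin N
-- (i ↦ σ_{i+1} - 1); on a finite set injective = bijective.
Perm : ℕ → Set
Perm N = Σ (Fin N → Fin N) (Injective _≡_ _≡_)

Word : ℕ → Set
Word N = Fin N → Fin N

-- Rotation: rotate σ r = σ_{r+1} σ_{r+2} … σ_N σ_1 … σ_r  (0-based index shift by r)
rotate : ∀ {N} → Word N → Fin N → Word N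
rotate {suc n} σ r i = σ ((toℕ i + toℕ r) mod (suc n))

ContainsLin : ∀ {N k} → Word N → (Fin k → Fin k) → Set
ContainsLin {N} {k} σ π =
  Σ (Fin k → Fin N) λ f →
    (∀ i j → i <ᶠ j → f i <ᶠ f j) ×
    (∀ i j → (π i <ᶠ π j) ⇔ (σ (f i) <ᶠ σ (f j)))

CycContains : ∀ {N k} → Word N → (Fin k → Fin k) → Set
CycContains {N} σ π = ∃ λ (r : Fin N) → ContainsLin (rotate σ r) π

ι : (k : ℕ) → Fin k → Fin k
ι k i = i

δ : (k : ℕ) → Fin k → Fin k
δ k i = opposite i

-- Containment: rotate [σ] so that its minimum comes first.  By Erdős–Szekeres the
-- other m n + 1 entries contain an increasing subsequence of length m + 1, which the
-- minimum extends in front to an occurrence of ι (m + 2), or a decreasing one of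
-- length n + 1, which the minimum, read one rotation later as the last entry,
-- extends to an occurrence of δ (n + 2).
--
-- Avoidance: take p ↦ n p mod N with N = m n + 1.  As m n ≡ -1 (mod N), an entry
-- of value v at position p of the rotation by r satisfies p + m v ≡ -r and
-- n p - v ≡ -n r (mod N).  The first quantity strictly increases along an occurrence
-- of ι k and the second along an occurrence of δ k; being constant mod N they grow
-- by at least N per step, yet stay below (m + 1) N and (n + 1) N respectively, so
-- k ≤ m + 1 and k ≤ n + 1.

module Submission where

open import Defs
open import Data.Empty using (⊥; ⊥-elim)
open import Data.Fin
  using (Fin; zero; suc; toℕ; fromℕ; fromℕ<; inject₁; inject≤; opposite; combine)
  renaming (_<_ to _<ᶠ_; _>_ to _>ᶠ_)
open import Data.Fin.Properties
  using (toℕ-injective; toℕ-fromℕ<; fromℕ<-injective; toℕ<n; toℕ-inject₁; toℕ-inject≤; toℕ-fromℕ; inject₁ℕ<; opposite-prop; any?; pigeonhole; combine-injective)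
  renaming (suc-injective to suc-injectiveᶠ)
open import Data.Nat
open import Data.Nat.DivMod
open import Data.Nat.Properties
open import Data.Nat.Tactic.RingSolver using (solve-∀)
open import Data.Vec.Functional using (_∷_)
open import Data.Product using (Σ; ∃; ∃₂; _×_; _,_; proj₁; proj₂)
open import Data.Sum using (_⊎_; inj₁; inj₂; [_,_]′)
open import Function using (_∘_; _⇔_; Equivalence; mk⇔; case_of_)
open import Function.Definitions using (Injective)
open import Relation.Binary using (Rel; Decidable; Transitive; _Preserves_⟶_; Tri; tri<; tri≈; tri>)
open import Relation.Binary.PropositionalEquality
open import Relation.Nullary using (¬_; yes; no)

%-gap : ∀ N .{{_ : NonZero N}} {x y} → x % N ≡ y % N → x < y → x + N ≤ y
%-gap N {x} {y} x≡y x<y = begin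
  x + N                    ≡⟨ cong (_+ N) (m≡m%n+[m/n]*n x N) ⟩
  x % N + x / N * N + N    ≡⟨ +-assoc (x % N) (x / N * N) N ⟩
  x % N + (x / N * N + N)  ≡⟨ cong₂ _+_ x≡y (+-comm (x / N * N) N) ⟩
  y % N + suc (x / N) * N  ≤⟨ +-monoʳ-≤ (y % N) (*-monoˡ-≤ N x/N<y/N) ⟩
  y % N + y / N * N        ≡⟨ m≡m%n+[m/n]*n y N ⟨
  y                        ∎
  where
  open ≤-Reasoning
  x/N<y/N : x / N < y / N
  x/N<y/N = *-cancelʳ-< N (x / N) (y / N) (+-cancelˡ-< (y % N) _ _
    (subst₂ _<_ (trans (m≡m%n+[m/n]*n x N) (cong (_+ x / N * N) x≡y)) (m≡m%n+[m/n]*n y N) x<y))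

%-+-cancelʳ : ∀ N .{{_ : NonZero N}} a {x y} → x < N → y < N → (x + a) % N ≡ (y + a) % N → x ≡ y
%-+-cancelʳ N a {x} {y} x<N y<N eq = by-cases (<-cmp x y)
  where
  N≤ : ∀ {u v} → (u + a) % N ≡ (v + a) % N → u < v → N ≤ v
  N≤ {u} {v} e u<v = ≤-trans (m≤n+m N u) (+-cancelʳ-≤ a (u + N) v (begin
    u + N + a    ≡⟨ +-assoc u N a ⟩
    u + (N + a)  ≡⟨ cong (u +_) (+-comm N a) ⟩
    u + (a + N)  ≡⟨ +-assoc u a N ⟨
    u + a + N    ≤⟨ %-gap N e (+-monoˡ-< a u<v) ⟩
    v + a        ∎))
    where open ≤-Reasoning
  by-cases : Tri (x < y) (x ≡ y) (x > y) → x ≡ y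
  by-cases (tri< x<y _ _) = ⊥-elim (<⇒≱ y<N (N≤ eq x<y))
  by-cases (tri≈ _ x≡y _) = x≡y
  by-cases (tri> _ _ y<x) = ⊥-elim (<⇒≱ x<N (N≤ (sym eq) y<x))

[m+n%d]%d≡[m+n]%d : ∀ m n d .{{_ : NonZero d}} → (m + n % d) % d ≡ (m + n) % d
[m+n%d]%d≡[m+n]%d m n d = begin
  (m + n % d) % d         ≡⟨ %-distribˡ-+ m (n % d) d ⟩
  (m % d + n % d % d) % d ≡⟨ cong (λ t → (m % d + t) % d) (m%n%n≡m%n n d) ⟩
  (m % d + n % d) % d     ≡⟨ %-distribˡ-+ m n d ⟨
  (m + n) % d             ∎
  where open ≡-Reasoning

[m*[n%d]]%d≡[m*n]%d : ∀ m n d .{{_ : NonZero d}} → (m * (n % d)) % d ≡ (m * n) % d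
[m*[n%d]]%d≡[m*n]%d m n d = begin
  (m * (n % d)) % d         ≡⟨ %-distribˡ-* m (n % d) d ⟩
  (m % d * (n % d % d)) % d ≡⟨ cong (λ t → (m % d * t) % d) (m%n%n≡m%n n d) ⟩
  (m % d * (n % d)) % d     ≡⟨ %-distribˡ-* m n d ⟨
  (m * n) % d               ∎
  where open ≡-Reasoning

[m+k*[n%d]]%d≡[m+k*n]%d : ∀ m k n d .{{_ : NonZero d}} → (m + k * (n % d)) % d ≡ (m + k * n) % d
[m+k*[n%d]]%d≡[m+k*n]%d m k n d = begin
  (m + k * (n % d)) % d     ≡⟨ [m+n%d]%d≡[m+n]%d m (k * (n % d)) d ⟨
  (m + k * (n % d) % d) % d ≡⟨ cong (λ t → (m + t) % d) ([m*[n%d]]%d≡[m*n]%d k n d) ⟩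
  (m + k * n % d) % d       ≡⟨ [m+n%d]%d≡[m+n]%d m (k * n) d ⟩
  (m + k * n) % d           ∎
  where open ≡-Reasoning

toℕ-mod : ∀ x N .{{_ : NonZero N}} → toℕ (x mod N) ≡ x % N
toℕ-mod x N = toℕ-fromℕ< (m%n<n x N)

opposite-reverses-< : ∀ {k} {i j : Fin k} → i <ᶠ j → opposite j <ᶠ opposite i
opposite-reverses-< {i = i} {j} i<j = subst₂ _<_ (sym (opposite-prop j)) (sym (opposite-prop i))
  (∸-monoʳ-< (s<s i<j) (toℕ<n j))

inject₁-mono-< : ∀ {M} {i j : Fin M} → i <ᶠ j → inject₁ i <ᶠ inject₁ j
inject₁-mono-< {i = i} {j} i<j = subst₂ _<_ (sym (toℕ-inject₁ i)) (sym (toℕ-inject₁ j)) i<j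

inject₁<fromℕ : ∀ {M} (j : Fin M) → inject₁ j <ᶠ fromℕ M
inject₁<fromℕ {M} j = subst (toℕ (inject₁ j) <_) (sym (toℕ-fromℕ M)) (inject₁ℕ< j)

∷-preserves : ∀ {b ℓ} {B : Set b} {R : Rel B ℓ} {k x} {f : Fin k → B} →
  (∀ t → R x (f t)) → f Preserves _<ᶠ_ ⟶ R → (x ∷ f) Preserves _<ᶠ_ ⟶ R
∷-preserves x-f f-mono {zero}  {suc t} _         = x-f t
∷-preserves x-f f-mono {suc s} {suc t} (s<s s<t) = f-mono s<t

strictlyIncreasing⇒⇔ : ∀ {k N} {g : Fin k → Fin N} → g Preserves _<ᶠ_ ⟶ _<ᶠ_ →
  ∀ i j → (i <ᶠ j) ⇔ (g i <ᶠ g j)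
strictlyIncreasing⇒⇔ {g = g} g-mono i j = mk⇔ g-mono reflect
  where
  reflect : g i <ᶠ g j → i <ᶠ j
  reflect gi<gj with <-cmp (toℕ i) (toℕ j)
  ... | tri< i<j _ _ = i<j
  ... | tri≈ _ i≡j _ = ⊥-elim (<-irrefl (cong (toℕ ∘ g) (toℕ-injective i≡j)) gi<gj)
  ... | tri> _ _ j<i = ⊥-elim (<-asym gi<gj (g-mono j<i))

ι-occurrence : ∀ {N k} (W : Word N) (f : Fin k → Fin N) →
  f Preserves _<ᶠ_ ⟶ _<ᶠ_ → (W ∘ f) Preserves _<ᶠ_ ⟶ _<ᶠ_ → ContainsLin W (ι k)
ι-occurrence W f f-mono Wf-mono = f , (λ _ _ → f-mono) , strictlyIncreasing⇒⇔ Wf-mono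

-- g lists the occurrence from right to left, so its values increase.
δ-occurrence : ∀ {N k} (W : Word N) (g : Fin k → Fin N) →
  g Preserves _<ᶠ_ ⟶ _>ᶠ_ → (W ∘ g) Preserves _<ᶠ_ ⟶ _<ᶠ_ → ContainsLin W (δ k)
δ-occurrence W g g-anti Wg-mono = g ∘ opposite , (λ _ _ i<j → g-anti (opposite-reverses-< i<j)) ,
  λ i j → strictlyIncreasing⇒⇔ Wg-mono (opposite i) (opposite j)

rotate-cong : ∀ {M} (σ : Word (suc M)) {r r′ i i′} →
  (toℕ i + toℕ r) % suc M ≡ (toℕ i′ + toℕ r′) % suc M → rotate σ r i ≡ rotate σ r′ i′
rotate-cong {M} σ {r} {r′} {i} {i′} eq = cong σ (toℕ-injective (begin
  toℕ ((toℕ i + toℕ r) mod suc M)    ≡⟨ toℕ-mod (toℕ i + toℕ r) (suc M) ⟩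
  (toℕ i + toℕ r) % suc M            ≡⟨ eq ⟩
  (toℕ i′ + toℕ r′) % suc M          ≡⟨ toℕ-mod (toℕ i′ + toℕ r′) (suc M) ⟨
  toℕ ((toℕ i′ + toℕ r′) mod suc M)  ∎))
  where open ≡-Reasoning

rotate-injective : ∀ {M} {σ : Word (suc M)} → Injective _≡_ _≡_ σ → ∀ r → Injective _≡_ _≡_ (rotate σ r)
rotate-injective {M} σ-inj r {i} {j} eq = toℕ-injective (%-+-cancelʳ (suc M) (toℕ r) (toℕ<n i) (toℕ<n j)
  (trans (sym (toℕ-mod (toℕ i + toℕ r) (suc M)))
  (trans (cong toℕ (σ-inj eq)) (toℕ-mod (toℕ j + toℕ r) (suc M)))))

rotate-zero : ∀ {M} (σ : Word (suc M)) r → rotate σ r zero ≡ σ r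
rotate-zero {M} σ r = cong σ (toℕ-injective (trans (toℕ-mod (toℕ r) (suc M)) (m<n⇒m%n≡m (toℕ<n r))))

next : ∀ {M} → Fin (suc M) → Fin (suc M)
next {M} r = suc (toℕ r) mod suc M

rotate-next-inject₁ : ∀ {M} (σ : Word (suc M)) r (j : Fin M) →
  rotate σ (next r) (inject₁ j) ≡ rotate σ r (suc j)
rotate-next-inject₁ {M} σ r j = rotate-cong σ {next r} {r} {inject₁ j} {suc j} (begin
  (toℕ (inject₁ j) + toℕ (next r)) % suc M  ≡⟨ cong₂ (λ a b → (a + b) % suc M) (toℕ-inject₁ j) (toℕ-mod (suc (toℕ r)) (suc M)) ⟩
  (toℕ j + suc (toℕ r) % suc M) % suc M     ≡⟨ [m+n%d]%d≡[m+n]%d (toℕ j) (suc (toℕ r)) (suc M) ⟩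
  (toℕ j + suc (toℕ r)) % suc M             ≡⟨ cong (_% suc M) (+-suc (toℕ j) (toℕ r)) ⟩
  (suc (toℕ j) + toℕ r) % suc M             ∎)
  where open ≡-Reasoning

rotate-next-fromℕ : ∀ {M} (σ : Word (suc M)) r → rotate σ (next r) (fromℕ M) ≡ rotate σ r zero
rotate-next-fromℕ {M} σ r = rotate-cong σ {next r} {r} {fromℕ M} {zero} (begin
  (toℕ (fromℕ M) + toℕ (next r)) % suc M  ≡⟨ cong₂ (λ a b → (a + b) % suc M) (toℕ-fromℕ M) (toℕ-mod (suc (toℕ r)) (suc M)) ⟩
  (M + suc (toℕ r) % suc M) % suc M       ≡⟨ [m+n%d]%d≡[m+n]%d M (suc (toℕ r)) (suc M) ⟩
  (M + suc (toℕ r)) % suc M               ≡⟨ cong (_% suc M) (trans (+-suc M (toℕ r)) (+-comm (suc M) (toℕ r))) ⟩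
  (toℕ r + suc M) % suc M                 ≡⟨ [m+n]%n≡m%n (toℕ r) (suc M) ⟩
  toℕ r % suc M                           ∎)
  where open ≡-Reasoning

congruent-spread : ∀ N .{{_ : NonZero N}} {k c} (x : Fin (suc k) → ℕ) →
  x Preserves _<ᶠ_ ⟶ _<_ → (∀ i → x i % N ≡ c) → x zero + k * N ≤ x (fromℕ k)
congruent-spread N {zero}  x _    _  = ≤-reflexive (+-identityʳ (x zero))
congruent-spread N {suc k} x mono ≡c = begin
  x zero + (N + k * N)  ≡⟨ +-assoc (x zero) N (k * N) ⟨
  x zero + N + k * N    ≤⟨ +-monoˡ-≤ (k * N) (%-gap N (trans (≡c zero) (sym (≡c (suc zero)))) (mono z<s)) ⟩
  x (suc zero) + k * N  ≤⟨ congruent-spread N (x ∘ suc) (λ i<j → mono (s<s i<j)) (≡c ∘ suc) ⟩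
  x (fromℕ (suc k))     ∎
  where open ≤-Reasoning

congruent-chain-bound : ∀ N .{{_ : NonZero N}} {k b c} (x : Fin (suc k) → ℕ) →
  x Preserves _<ᶠ_ ⟶ _<_ → (∀ i → x i % N ≡ c) → x (fromℕ k) < suc b * N → k ≤ b
congruent-chain-bound N {k} {b} x mono ≡c x<bN = s≤s⁻¹ (*-cancelʳ-< N k (suc b)
  (≤-<-trans (≤-trans (m≤n+m (k * N) (x zero)) (congruent-spread N x mono ≡c)) x<bN))

stride : (m n : ℕ) → Word (suc (m * n))
stride m n p = (n * toℕ p) mod suc (m * n)

toℕ-rotate-stride : ∀ m n r p → toℕ (rotate (stride m n) r p) ≡ n * (toℕ p + toℕ r) % suc (m * n)
toℕ-rotate-stride m n r p = begin
  toℕ (rotate (stride m n) r p)         ≡⟨ toℕ-mod (n * toℕ ((toℕ p + toℕ r) mod N)) N ⟩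
  n * toℕ ((toℕ p + toℕ r) mod N) % N   ≡⟨ cong (λ t → n * t % N) (toℕ-mod (toℕ p + toℕ r) N) ⟩
  n * ((toℕ p + toℕ r) % N) % N         ≡⟨ [m*[n%d]]%d≡[m*n]%d n _ N ⟩
  n * (toℕ p + toℕ r) % N               ∎
  where
  open ≡-Reasoning
  N = suc (m * n)

ascent-invariant : ∀ m n p r →
  (p + m * (n * (p + r) % suc (m * n))) % suc (m * n) ≡ m * n * r % suc (m * n)
ascent-invariant m n p r = begin
  (p + m * (n * (p + r) % N)) % N  ≡⟨ [m+k*[n%d]]%d≡[m+k*n]%d p m (n * (p + r)) N ⟩
  (p + m * (n * (p + r))) % N      ≡⟨ cong (_% N) (expand m n p r) ⟩
  (m * n * r + p * N) % N          ≡⟨ [m+kn]%n≡m%n (m * n * r) p N ⟩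
  m * n * r % N                    ∎
  where
  open ≡-Reasoning
  N = suc (m * n)
  expand : ∀ m n p r → p + m * (n * (p + r)) ≡ m * n * r + p * suc (m * n)
  expand = solve-∀

-- m n ∸ v stands for -1 - v (mod N); v ≤ m n, so the subtraction never truncates.
descent-invariant : ∀ m n p r →
  (m * n ∸ n * (p + r) % suc (m * n) + n * p) % suc (m * n) ≡ (m * n + m * n * n * r) % suc (m * n)
descent-invariant m n p r = begin
  (M ∸ V + n * p) % N                  ≡⟨ [m+kn]%n≡m%n (M ∸ V + n * p) V N ⟨
  (M ∸ V + n * p + V * N) % N          ≡⟨ cong (_% N) (regroup (M ∸ V) (n * p) V M) ⟩
  (n * p + (M ∸ V + V) + M * V) % N    ≡⟨ cong (λ t → (n * p + t + M * V) % N) (m∸n+n≡m V≤M) ⟩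
  (n * p + M + M * V) % N              ≡⟨ [m+k*[n%d]]%d≡[m+k*n]%d (n * p + M) M (n * (p + r)) N ⟩
  (n * p + M + M * (n * (p + r))) % N  ≡⟨ cong (_% N) (expand m n p r) ⟩
  (M + M * n * r + n * p * N) % N      ≡⟨ [m+kn]%n≡m%n (M + M * n * r) (n * p) N ⟩
  (M + M * n * r) % N                  ∎
  where
  open ≡-Reasoning
  M = m * n
  N = suc M
  V = n * (p + r) % N
  V≤M : V ≤ M
  V≤M = s≤s⁻¹ (m%n<n (n * (p + r)) N)
  regroup : ∀ d a v M → d + a + v * suc M ≡ a + (d + v) + M * v
  regroup = solve-∀
  expand : ∀ m n p r → n * p + m * n + m * n * (n * (p + r)) ≡ m * n + m * n * n * r + n * p * suc (m * n)
  expand = solve-∀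

stride-injective : ∀ m n → Injective _≡_ _≡_ (stride m n)
stride-injective m n {p} {q} sp≡sq = toℕ-injective
  (%-+-cancelʳ N (m * toℕ (stride m n q)) (toℕ<n p) (toℕ<n q) (begin
    (toℕ p + m * toℕ (stride m n q)) % N  ≡⟨ cong (λ s → (toℕ p + m * toℕ s) % N) sp≡sq ⟨
    (toℕ p + m * toℕ (stride m n p)) % N  ≡⟨ potential p ⟩
    m * n * 0 % N                         ≡⟨ potential q ⟨
    (toℕ q + m * toℕ (stride m n q)) % N  ∎))
  where
  open ≡-Reasoning
  N = suc (m * n)
  potential : ∀ p → (toℕ p + m * toℕ (stride m n p)) % N ≡ m * n * 0 % N
  potential p = begin
    (toℕ p + m * toℕ (stride m n p)) % N    ≡⟨ cong (λ v → (toℕ p + m * v) % N) (toℕ-mod (n * toℕ p) N) ⟩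
    (toℕ p + m * (n * toℕ p % N)) % N       ≡⟨ cong (λ t → (toℕ p + m * (n * t % N)) % N) (+-identityʳ (toℕ p)) ⟨
    (toℕ p + m * (n * (toℕ p + 0) % N)) % N ≡⟨ ascent-invariant m n (toℕ p) 0 ⟩
    m * n * 0 % N                           ∎

stride-ascent-bound : ∀ m n {k} → CycContains (stride m n) (ι (suc k)) → k ≤ m
stride-ascent-bound m n {k} (r , f , f-mono , iso) =
  congruent-chain-bound N x x-mono x-congruent x<[1+m]N
  where
  N = suc (m * n)
  V : Fin (suc k) → ℕ
  V i = toℕ (rotate (stride m n) r (f i))
  x : Fin (suc k) → ℕ
  x i = toℕ (f i) + m * V i
  x-mono : x Preserves _<ᶠ_ ⟶ _<_
  x-mono {i} {j} i<j = +-mono-<-≤ (f-mono i j i<j) (*-monoʳ-≤ m (<⇒≤ (Equivalence.to (iso i j) i<j)))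
  x-congruent : ∀ i → x i % N ≡ m * n * toℕ r % N
  x-congruent i = trans (cong (λ v → (toℕ (f i) + m * v) % N) (toℕ-rotate-stride m n r (f i)))
                        (ascent-invariant m n (toℕ (f i)) (toℕ r))
  x<[1+m]N : x (fromℕ k) < suc m * N
  x<[1+m]N = +-mono-<-≤ (toℕ<n (f (fromℕ k))) (*-monoʳ-≤ m (<⇒≤ (toℕ<n _)))

stride-descent-bound : ∀ m n {k} → CycContains (stride m n) (δ (suc k)) → k ≤ n
stride-descent-bound m n {k} (r , f , f-mono , iso) =
  congruent-chain-bound N x x-mono x-congruent x<[1+n]N
  where
  N = suc (m * n)
  V : Fin (suc k) → ℕ
  V i = toℕ (rotate (stride m n) r (f i))
  V≤mn : ∀ i → V i ≤ m * n
  V≤mn i = s≤s⁻¹ (toℕ<n _)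
  x : Fin (suc k) → ℕ
  x i = m * n ∸ V i + n * toℕ (f i)
  x-mono : x Preserves _<ᶠ_ ⟶ _<_
  x-mono {i} {j} i<j = +-mono-<-≤ (∸-monoʳ-< (Equivalence.to (iso j i) (opposite-reverses-< i<j)) (V≤mn i))
                                  (*-monoʳ-≤ n (<⇒≤ (f-mono i j i<j)))
  x-congruent : ∀ i → x i % N ≡ (m * n + m * n * n * toℕ r) % N
  x-congruent i = trans (cong (λ v → (m * n ∸ v + n * toℕ (f i)) % N) (toℕ-rotate-stride m n r (f i)))
                        (descent-invariant m n (toℕ (f i)) (toℕ r))
  x<[1+n]N : x (fromℕ k) < suc n * N
  x<[1+n]N = +-mono-<-≤ (s≤s (m∸n≤m (m * n) (V (fromℕ k)))) (*-monoʳ-≤ n (<⇒≤ (toℕ<n (f (fromℕ k)))))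

maximum : ∀ {k} → (Fin k → ℕ) → ℕ
maximum {zero}  g = 0
maximum {suc k} g = g zero ⊔ maximum (g ∘ suc)

≤-maximum : ∀ {k} (g : Fin k → ℕ) i → g i ≤ maximum g
≤-maximum g zero    = m≤m⊔n (g zero) _
≤-maximum g (suc i) = ≤-trans (≤-maximum (g ∘ suc) i) (m≤n⊔m (g zero) _)

maximum-attained : ∀ {k} (g : Fin k → ℕ) → maximum g ≡ 0 ⊎ ∃ λ i → maximum g ≡ g i
maximum-attained {zero}  g = inj₁ refl
maximum-attained {suc k} g with ⊔-sel (g zero) (maximum (g ∘ suc))
... | inj₁ eq = inj₂ (zero , eq)
... | inj₂ eq with maximum-attained (g ∘ suc)
...   | inj₁ eq0       = inj₁ (trans eq eq0)
...   | inj₂ (i , eqi) = inj₂ (suc i , trans eq eqi)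

module LongestChain {a ℓ} {A : Set a} {_≺_ : Rel A ℓ}
  (_≺?_ : Decidable _≺_) (≺-trans : Transitive _≺_) where

  Link : ∀ {k} → (Fin k → A) → Rel (Fin k) ℓ
  Link τ i j = i <ᶠ j × τ i ≺ τ j

  Link-trans : ∀ {k} {τ : Fin k → A} → Transitive (Link τ)
  Link-trans (i<j , ij) (j<k , jk) = <-trans i<j j<k , ≺-trans ij jk

  IsChain : ∀ {k h} → (Fin k → A) → (Fin h → Fin k) → Set ℓ
  IsChain τ c = c Preserves _<ᶠ_ ⟶ Link τ

  Chain : ∀ {k} → (Fin k → A) → ℕ → Fin k → Set ℓ
  Chain {k} τ h i = Σ (Fin (suc h) → Fin k) λ c → c zero ≡ i × IsChain τ c

  mutual
    height : ∀ {k} → (Fin k → A) → Fin k → ℕ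
    height τ zero    = maximum (heightVia τ)
    height τ (suc i) = height (τ ∘ suc) i

    heightVia : ∀ {k} → (Fin (suc k) → A) → Fin k → ℕ
    heightVia τ j with τ zero ≺? τ (suc j)
    ... | yes _ = suc (height (τ ∘ suc) j)
    ... | no _  = 0

  singleton : ∀ {k} {τ : Fin k → A} i → Chain τ 0 i
  singleton i = (λ _ → i) , refl , λ { {zero} {zero} () }

  shift : ∀ {k h} {τ : Fin (suc k) → A} {i} → Chain (τ ∘ suc) h i → Chain τ h (suc i)
  shift (c , refl , c-chain) = suc ∘ c , refl , λ s<t → let (p , r) = c-chain s<t in s<s p , r

  cons : ∀ {k h} {τ : Fin k → A} {i j} → Link τ i j → Chain τ h j → Chain τ (suc h) i
  cons {τ = τ} {i} i→j (c , refl , c-chain) = i ∷ c , refl , ∷-preserves {R = Link τ} i→c c-chain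
    where
    i→c : ∀ t → Link τ i (c t)
    i→c zero    = i→j
    i→c (suc t) = Link-trans i→j (c-chain z<s)

  height-chain : ∀ {k} (τ : Fin k → A) i → Chain τ (height τ i) i
  height-chain τ (suc i) = shift {τ = τ} (height-chain (τ ∘ suc) i)
  height-chain τ zero with maximum-attained (heightVia τ)
  ... | inj₁ eq0      = subst (λ h → Chain τ h zero) (sym eq0) (singleton {τ = τ} zero)
  ... | inj₂ (j , eq) = subst (λ h → Chain τ h zero) (sym eq) (via j)
    where
    via : ∀ j → Chain τ (heightVia τ j) zero
    via j with τ zero ≺? τ (suc j)
    ... | yes r = cons {τ = τ} (z<s , r) (shift {τ = τ} (height-chain (τ ∘ suc) j))
    ... | no _  = singleton {τ = τ} zero

  height-decreases : ∀ {k} (τ : Fin k → A) {i j} → Link τ i j → height τ j < height τ i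
  height-decreases τ {zero}  {suc j} (_ , r)       = ≤-trans (via-link j r) (≤-maximum (heightVia τ) j)
    where
    via-link : ∀ j → τ zero ≺ τ (suc j) → suc (height (τ ∘ suc) j) ≤ heightVia τ j
    via-link j r with τ zero ≺? τ (suc j)
    ... | yes _ = ≤-refl
    ... | no ¬r = ⊥-elim (¬r r)
  height-decreases τ {suc i} {suc j} (s<s i<j , r) = height-decreases (τ ∘ suc) (i<j , r)

  chain-prefix : ∀ {k h i} {τ : Fin k → A} → Chain τ h i →
    ∀ {m} → m ≤ h → ∃ λ (c : Fin (suc m) → Fin k) → IsChain τ c
  chain-prefix (c , _ , c-chain) m≤h = (λ t → c (inject≤ t (s≤s m≤h))) , λ {s} {t} s<t →
    c-chain (subst₂ _<_ (sym (toℕ-inject≤ s (s≤s m≤h))) (sym (toℕ-inject≤ t (s≤s m≤h))) s<t)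

module Ascending = LongestChain {A = ℕ} _<?_ <-trans
module Descending = LongestChain {A = ℕ} _>?_ (λ x>y y>z → <-trans y>z x>y)

heights-separate : ∀ {k} (τ : Fin k → ℕ) → Injective _≡_ _≡_ τ → ∀ {i j} → i <ᶠ j →
  ¬ (Ascending.height τ i ≡ Ascending.height τ j × Descending.height τ i ≡ Descending.height τ j)
heights-separate τ τ-inj {i} {j} i<j (↑≡ , ↓≡) with <-cmp (τ i) (τ j)
... | tri< τi<τj _ _ = <-irrefl (sym ↑≡) (Ascending.height-decreases τ (i<j , τi<τj))
... | tri≈ _ τi≡τj _ = <-irrefl (cong toℕ (τ-inj τi≡τj)) i<j
... | tri> _ _ τj<τi = <-irrefl (sym ↓≡) (Descending.height-decreases τ (i<j , τj<τi))

erdős-szekeres : ∀ m n {k} → m * n < k → (τ : Fin k → ℕ) → Injective _≡_ _≡_ τ →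
  (∃ λ (c : Fin (suc m) → Fin k) → Ascending.IsChain τ c) ⊎
  (∃ λ (c : Fin (suc n) → Fin k) → Descending.IsChain τ c)
erdős-szekeres m n {k} mn<k τ τ-inj with any? (λ i → m ≤? Ascending.height τ i)
... | yes (i , m≤h) = inj₁ (Ascending.chain-prefix {τ = τ} (Ascending.height-chain τ i) m≤h)
... | no ¬long↑ with any? (λ i → n ≤? Descending.height τ i)
...   | yes (i , n≤h) = inj₂ (Descending.chain-prefix {τ = τ} (Descending.height-chain τ i) n≤h)
...   | no ¬long↓ = ⊥-elim (collide (pigeonhole mn<k label))
  where
  short↑ : ∀ i → Ascending.height τ i < m
  short↑ i = ≰⇒> (¬long↑ ∘ (i ,_))
  short↓ : ∀ i → Descending.height τ i < n
  short↓ i = ≰⇒> (¬long↓ ∘ (i ,_))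
  label : Fin k → Fin (m * n)
  label i = combine (fromℕ< (short↑ i)) (fromℕ< (short↓ i))
  collide : (∃₂ λ i j → i <ᶠ j × label i ≡ label j) → ⊥
  collide (i , j , i<j , same-label) = heights-separate τ τ-inj i<j
    (fromℕ<-injective _ _ (short↑ i) (short↑ j) (proj₁ same-heights) ,
     fromℕ<-injective _ _ (short↓ i) (short↓ j) (proj₂ same-heights))
    where
    same-heights = combine-injective (fromℕ< (short↑ i)) (fromℕ< (short↓ i))
                                     (fromℕ< (short↑ j)) (fromℕ< (short↓ j)) same-label

argmin : ∀ {k} (g : Fin (suc k) → ℕ) → ∃ λ p → ∀ q → g p ≤ g q
argmin {zero}  g = zero , λ { zero → ≤-refl }
argmin {suc k} g with argmin (g ∘ suc)
... | p , min-p with g zero ≤? g (suc p)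
...   | yes g0≤ = zero , λ { zero → ≤-refl ; (suc q) → ≤-trans g0≤ (min-p q) }
...   | no g0≰  = suc p , λ { zero → <⇒≤ (≰⇒> g0≰) ; (suc q) → min-p q }

cyclic-erdős-szekeres : ∀ m n (σ : Perm (suc (suc (m * n)))) →
  CycContains (proj₁ σ) (ι (suc (suc m))) ⊎ CycContains (proj₁ σ) (δ (suc (suc n)))
cyclic-erdős-szekeres m n (s , s-inj) =
  [ inj₁ ∘ ascent , inj₂ ∘ descent ]′ (erdős-szekeres m n ≤-refl τ τ-inj)
  where
  p₀ = proj₁ (argmin (toℕ ∘ s))
  W = rotate s p₀
  τ : Fin (suc (m * n)) → ℕ
  τ j = toℕ (W (suc j))
  τ-inj : Injective _≡_ _≡_ τ
  τ-inj eq = suc-injectiveᶠ (rotate-injective s-inj p₀ (toℕ-injective eq))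
  min-first : ∀ j → W zero <ᶠ W (suc j)
  min-first j = ≤∧≢⇒< (subst (λ v → toℕ v ≤ τ j) (sym (rotate-zero s p₀)) (proj₂ (argmin (toℕ ∘ s)) _))
    (λ eq → case rotate-injective s-inj p₀ {zero} {suc j} (toℕ-injective eq) of λ ())
  ascent : (∃ λ c → Ascending.IsChain τ c) → CycContains s (ι (suc (suc m)))
  ascent (c , c-chain) = p₀ , ι-occurrence W (zero ∷ (suc ∘ c))
    (∷-preserves {R = _<ᶠ_} (λ _ → z<s) (λ s<t → s<s (proj₁ (c-chain s<t)))) values
    where
    values : (W ∘ (zero ∷ (suc ∘ c))) Preserves _<ᶠ_ ⟶ _<ᶠ_
    values {zero}  {suc t} _         = min-first (c t)
    values {suc _} {suc _} (s<s s<t) = proj₂ (c-chain s<t)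
  descent : (∃ λ c → Descending.IsChain τ c) → CycContains s (δ (suc (suc n)))
  descent (c , c-chain) = next p₀ , δ-occurrence W′ (fromℕ (suc (m * n)) ∷ (inject₁ ∘ c ∘ opposite))
    (∷-preserves {R = _>ᶠ_} (λ t → inject₁<fromℕ (c (opposite t)))
      (λ u<t → inject₁-mono-< (proj₁ (c-chain (opposite-reverses-< u<t)))))
    values
    where
    W′ = rotate s (next p₀)
    values : (W′ ∘ (fromℕ (suc (m * n)) ∷ (inject₁ ∘ c ∘ opposite))) Preserves _<ᶠ_ ⟶ _<ᶠ_
    values {zero}  {suc t} _ = subst₂ _<ᶠ_
      (sym (rotate-next-fromℕ s p₀)) (sym (rotate-next-inject₁ s p₀ (c (opposite t))))
      (min-first (c (opposite t)))
    values {suc u} {suc t} (s<s u<t) = subst₂ _<ᶠ_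
      (sym (rotate-next-inject₁ s p₀ (c (opposite u)))) (sym (rotate-next-inject₁ s p₀ (c (opposite t))))
      (proj₂ (c-chain (opposite-reverses-< u<t)))

mainTheorem1 : (m n : ℕ) →
    ((σ : Perm (m * n + 2)) →
      CycContains (proj₁ σ) (ι (m + 2)) ⊎ CycContains (proj₁ σ) (δ (n + 2)))
    × Σ (Perm (m * n + 1)) (λ σ →
      ¬ CycContains (proj₁ σ) (ι (m + 2)) × ¬ CycContains (proj₁ σ) (δ (n + 2)))
mainTheorem1 m n rewrite +-comm (m * n) 2 | +-comm (m * n) 1 | +-comm m 2 | +-comm n 2 =
  cyclic-erdős-szekeres m n ,
  (stride m n , stride-injective m n) ,
  (λ occ → 1+n≰n (stride-ascent-bound m n occ)) ,
  (λ occ → 1+n≰n (stride-descent-bound m n occ))
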